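{- If $G$ is a connected $2$-$\gamma_{\rm MB}'$-critical graph, then (i) $n(G)\ge 5$, (ii) $\delta(G)\ge 2$, and (iii) $\Delta(G)\le n(G)-2$. Moreover, each of these three bounds is attained (with equality) by some connected $2$-$\gamma_{\rm MB}'$-critical graph.
   Context: $n(G)$ is the number of vertices of $G$, $\delta(G)$ and $\Delta(G)$ its minimum and maximum degree. The Maker-Breaker domination (MBD) game on a graph $G$ is played by Dominator and Staller, who alternately select previously unselected vertices of $G$. Dominator wins if the set of vertices he has selected becomes a dominating set of $G$; Staller wins if she has selected at least one vertex of every dominating set of $G$. In the S-game Staller moves first. $\gamma_{\rm MB}'(G)$ is the minimum number $k$ such that Dominator has a strategy in the S-game guaranteeing that he wins having made at most $k$ moves, whatever Staller does; $\gamma_{\rm MB}'(G)=\infty$ if Dominator has no winning strategy in the S-game. A graph $G$ is $k$-$\gamma_{\rm MB}'$-critical if $\gamma_{\rm MB}'(G)=k$ and $\gamma_{\rm MB}'(G)<\gamma_{\rm MB}'(G-e)$ for every $e\in E(G)$. -}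

module Defs where

open import Data.Nat using (ℕ; zero; suc; _+_; _<_)
open import Data.Bool using (Bool; true; false; _∧_; _∨_; not)
open import Data.Fin using (Fin; zero; suc; _≟_)
open import Data.Fin.Subset using (Subset; _∈_; _∉_; _∪_; ⁅_⁆; ⊥)
open import Data.Product using (Σ; ∃; _×_; _,_)
open import Data.Sum using (_⊎_)
open import Relation.Nullary using (¬_)
open import Relation.Nullary.Decidable using (⌊_⌋)
open import Relation.Binary.PropositionalEquality using (_≡_)

Adj : ℕ → Set
Adj n = Fin n → Fin n → Bool

record Graph (n : ℕ) : Set where
  field
    adj     : Adj n
    symm    : ∀ x y → adj x y ≡ adj y x
    irrefl  : ∀ x → adj x x ≡ false
open Graph public

count : ∀ {n} → (Fin n → Bool) → ℕ
count {zero}  p = 0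
count {suc n} p with p zero
... | true  = suc (count (λ i → p (suc i)))
... | false = count (λ i → p (suc i))

degree : ∀ {n} → Graph n → Fin n → ℕ
degree G v = count (adj G v)

data Reach {n} (a : Adj n) : Fin n → Fin n → Set where
  here : ∀ {x} → Reach a x x
  step : ∀ {x y z} → a x y ≡ true → Reach a y z → Reach a x z

Connected : ∀ {n} → Graph n → Set
Connected {n} G = ∀ (x y : Fin n) → Reach (adj G) x y

removeEdge : ∀ {n} → Adj n → Fin n → Fin n → Adj n
removeEdge a u v x y =
  a x y ∧ not ((⌊ x ≟ u ⌋ ∧ ⌊ y ≟ v ⌋) ∨ (⌊ x ≟ v ⌋ ∧ ⌊ y ≟ u ⌋))

Dominating : ∀ {n} → Adj n → Subset n → Set
Dominating {n} a D = ∀ (v : Fin n) → v ∈ D ⊎ (∃ λ u → u ∈ D × a u v ≡ true)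

StallerWon : ∀ {n} → Adj n → Subset n → Set
StallerWon {n} a S = ∀ (D' : Subset n) → Dominating a D' → ∃ λ v → v ∈ D' × v ∈ S

-- DWin a k D S : Dominator to move, current selections D (Dominator) and
--   S (Staller); Dominator can force a win making at most k further moves.
-- SWin a k D S : same, with Staller to move.

mutual
  data DWin {n} (a : Adj n) : ℕ → Subset n → Subset n → Set where
    d-done : ∀ {k D S} → Dominating a D → DWin a k D S
    d-move : ∀ {k D S} → ¬ StallerWon a S → (u : Fin n) → u ∉ D → u ∉ S →
             SWin a k (D ∪ ⁅ u ⁆) S → DWin a (suc k) D S

  data SWin {n} (a : Adj n) : ℕ → Subset n → Subset n → Set where
    s-done : ∀ {k D S} → Dominating a D → SWin a k D S
    s-all  : ∀ {k D S} → ¬ StallerWon a S →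
             (∀ (v : Fin n) → v ∉ D → v ∉ S →
                ¬ StallerWon a (S ∪ ⁅ v ⁆) × DWin a k D (S ∪ ⁅ v ⁆)) →
             SWin a k D S

data ℕ∞ : Set where
  fin : ℕ → ℕ∞
  ∞   : ℕ∞

data _<∞_ : ℕ∞ → ℕ∞ → Set where
  fin<fin : ∀ {j k} → j < k → fin j <∞ fin k
  fin<∞   : ∀ {j} → fin j <∞ ∞

-- γ'_MB(a) = m  (S-game: Staller moves first, from the empty position)
IsGammaMB' : ∀ {n} → Adj n → ℕ∞ → Set
IsGammaMB' a (fin k) = SWin a k ⊥ ⊥ × (∀ j → j < k → ¬ SWin a j ⊥ ⊥)
IsGammaMB' a ∞       = ∀ k → ¬ SWin a k ⊥ ⊥

Critical : ∀ {n} → ℕ → Graph n → Set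
Critical {n} k G =
  IsGammaMB' (adj G) (fin k) ×
  (∀ (u v : Fin n) → adj G u v ≡ true →
     ∀ m → IsGammaMB' (removeEdge (adj G) u v) m → fin k <∞ m)

{-# OPTIONS --safe #-}
-- With Staller moving first, γ'_MB ≤ 1 says that every opening v is answered by a universal
-- vertex d ≠ v, and γ'_MB ≤ 2 says that it is answered by some d ≠ v which is universal or has
-- two partners: vertices w outside {v, d} with {d, w} dominating. So a 2-critical graph has
-- the second property, lacks the first, and loses the second when any edge is deleted.
-- If x were a leaf with neighbour y, Staller's y would have to be answered by x with partners
-- w₁, w₂ dominating everything outside {x, y}; a path from w₁ to x enters {x, y} through an
-- edge yp, and G − yp keeps the second property. If u were adjacent to all other vertices,
-- the partners of its answer d would have no neighbours outside {u, d} (otherwise deleting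
-- their edge to u is harmless), which makes d universal too; but two universal vertices give
-- γ'_MB ≤ 1. Hence 2 ≤ δ ≤ Δ ≤ n − 2, so n ≥ 4, and the only 2-regular graph on four
-- vertices, C₄, is not critical. C₅ and K₂,₃ attain the bounds.
module Submission where

open import Defs
open import Data.Bool using (Bool; true; false; _∧_; _∨_; not) renaming (_≟_ to _≟ᵇ_)
open import Data.Bool.ListAction using (any)
open import Data.Empty using (⊥; ⊥-elim)
open import Data.Fin using (Fin; zero; suc; _≟_)
open import Data.Fin.Patterns using (0F; 1F; 2F; 3F; 4F)
open import Data.Fin.Properties using (all?; any?)
open import Data.Fin.Subset using (Subset; _∈_; _∉_; _∪_; ⁅_⁆; ⊤; _⊆_) renaming (⊥ to ∅)
open import Data.Fin.Subset.Properties using (∉⊥; ∈⊤; x∈⁅x⁆; x∈⁅y⁆⇒x≡y; x∈p∪q⁻; x∈p∪q⁺; _∈?_)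
open import Data.List using (List; []; _∷_)
open import Data.Nat using (ℕ; zero; suc; _+_; _∸_; _≤_; _<_; z≤n; s≤s; _≤?_) renaming (_≟_ to _≟ℕ_)
open import Data.Nat.Induction using (<-rec)
open import Data.Nat.Properties
  using (≤-refl; ≤-trans; ≤-antisym; m≤n⇒m<n∨m≡n; ≰⇒>; <⇒≤; <⇒≱; +-suc; m+n∸n≡m; ∸-monoʳ-≤; module ≤-Reasoning)
open import Data.Product using (Σ; ∃; _×_; _,_; proj₁; proj₂)
open import Data.Sum using (_⊎_; inj₁; inj₂; swap; map; map₂)
open import Function using (_∘_; case_of_)
open import Relation.Nullary using (¬_; Dec; yes; no)
open import Relation.Nullary.Decidable
  using (¬?; _×-dec_; _⊎-dec_; _→-dec_; ⌊_⌋; True; toWitness; map′; from-yes)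
open import Relation.Binary.PropositionalEquality using (_≡_; _≢_; refl; sym; trans; cong; ≢-sym)

Dominates : ∀ {n} → Adj n → Fin n → Fin n → Set
Dominates a d z = z ≡ d ⊎ a d z ≡ true

Universal : ∀ {n} → Adj n → Fin n → Set
Universal a d = ∀ z → Dominates a d z

DominatingPair : ∀ {n} → Adj n → Fin n → Fin n → Set
DominatingPair a d w = ∀ z → Dominates a d z ⊎ Dominates a w z

Partner : ∀ {n} → Adj n → Fin n → Fin n → Fin n → Set
Partner a v d w = w ≢ v × w ≢ d × DominatingPair a d w

TwoPartners : ∀ {n} → Adj n → Fin n → Fin n → Set
TwoPartners {n} a v d =
  Σ (Fin n) λ w₁ → Σ (Fin n) λ w₂ → w₁ ≢ w₂ × Partner a v d w₁ × Partner a v d w₂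

-- Answerableₖ a characterises γ'_MB ≤ k for k = 1, 2 (Game.sWinₖ⇒answerableₖ and converse).
-- A non-universal answer d needs two partners, since Staller's next move can take one.
Answerable₁ : ∀ {n} → Adj n → Set
Answerable₁ {n} a = ∀ v → Σ (Fin n) λ d → d ≢ v × Universal a d

Answerable₂ : ∀ {n} → Adj n → Set
Answerable₂ {n} a = ∀ v → Σ (Fin n) λ d → d ≢ v × (Universal a d ⊎ TwoPartners a v d)

module _ {n} (a : Adj n) where

  dominates? : ∀ d z → Dec (Dominates a d z)
  dominates? d z = (z ≟ d) ⊎-dec (a d z ≟ᵇ true)

  universal? : ∀ d → Dec (Universal a d)
  universal? d = all? (dominates? d)

  dominatingPair? : ∀ d w → Dec (DominatingPair a d w)
  dominatingPair? d w = all? λ z → dominates? d z ⊎-dec dominates? w z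

  partner? : ∀ v d w → Dec (Partner a v d w)
  partner? v d w = ¬? (w ≟ v) ×-dec ¬? (w ≟ d) ×-dec dominatingPair? d w

  twoPartners? : ∀ v d → Dec (TwoPartners a v d)
  twoPartners? v d = any? λ w₁ → any? λ w₂ →
    ¬? (w₁ ≟ w₂) ×-dec partner? v d w₁ ×-dec partner? v d w₂

  answerable₁? : Dec (Answerable₁ a)
  answerable₁? = all? λ v → any? λ d → ¬? (d ≟ v) ×-dec universal? d

  answerable₂? : Dec (Answerable₂ a)
  answerable₂? = all? λ v → any? λ d → ¬? (d ≟ v) ×-dec (universal? d ⊎-dec twoPartners? v d)

  dominating? : ∀ D → Dec (Dominating a D)
  dominating? D = all? λ v → (v ∈? D) ⊎-dec any? λ u → (u ∈? D) ×-dec (a u v ≟ᵇ true)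

swapPair : ∀ {n} {a : Adj n} {d w} → DominatingPair a d w → DominatingPair a w d
swapPair p z = swap (p z)

one-of-two-avoids : ∀ {n} {P : Fin n → Set} {w₁ w₂} → w₁ ≢ w₂ → P w₁ → P w₂ →
                    ∀ x → Σ (Fin n) λ w → P w × w ≢ x
one-of-two-avoids {w₁ = w₁} w₁≢w₂ p₁ p₂ x with w₁ ≟ x
... | yes refl = _ , p₂ , ≢-sym w₁≢w₂
... | no w₁≢x  = _ , p₁ , w₁≢x

-- Staller's set after her opening move v is ∅ ∪ ⁅ v ⁆, hence this form.
sing : ∀ {n} → Fin n → Subset n
sing y = ∅ ∪ ⁅ y ⁆

pair : ∀ {n} → Fin n → Fin n → Subset n
pair y z = sing y ∪ ⁅ z ⁆

∈sing⁺ : ∀ {n} {y : Fin n} → y ∈ sing y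
∈sing⁺ {y = y} = x∈p∪q⁺ {p = ∅} (inj₂ (x∈⁅x⁆ y))

∈sing⁻ : ∀ {n} {x y : Fin n} → x ∈ sing y → x ≡ y
∈sing⁻ {y = y} x∈ with x∈p∪q⁻ ∅ ⁅ y ⁆ x∈
... | inj₁ x∈∅ = ⊥-elim (∉⊥ x∈∅)
... | inj₂ x∈y = x∈⁅y⁆⇒x≡y y x∈y

∉sing⁺ : ∀ {n} {x y : Fin n} → x ≢ y → x ∉ sing y
∉sing⁺ x≢y = x≢y ∘ ∈sing⁻

∉sing⁻ : ∀ {n} {x y : Fin n} → x ∉ sing y → x ≢ y
∉sing⁻ x∉ refl = x∉ ∈sing⁺

∈pair⁺ˡ : ∀ {n} {y z : Fin n} → y ∈ pair y z
∈pair⁺ˡ = x∈p∪q⁺ (inj₁ ∈sing⁺)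

∈pair⁺ʳ : ∀ {n} {y z : Fin n} → z ∈ pair y z
∈pair⁺ʳ {y = y} {z} = x∈p∪q⁺ {p = sing y} (inj₂ (x∈⁅x⁆ z))

∈pair⁻ : ∀ {n} {x y z : Fin n} → x ∈ pair y z → x ≡ y ⊎ x ≡ z
∈pair⁻ {y = y} {z} x∈ with x∈p∪q⁻ (sing y) ⁅ z ⁆ x∈
... | inj₁ x∈y = inj₁ (∈sing⁻ x∈y)
... | inj₂ x∈z = inj₂ (x∈⁅y⁆⇒x≡y z x∈z)

∉pair⁺ : ∀ {n} {x y z : Fin n} → x ≢ y → x ≢ z → x ∉ pair y z
∉pair⁺ x≢y x≢z x∈ with ∈pair⁻ x∈
... | inj₁ x≡y = x≢y x≡y
... | inj₂ x≡z = x≢z x≡z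

∉∪⁅⁆⁻ : ∀ {n} {S : Subset n} {x y} → x ∉ S ∪ ⁅ y ⁆ → x ∉ S × x ≢ y
∉∪⁅⁆⁻ {S = S} {x} x∉ = (λ x∈S → x∉ (x∈p∪q⁺ (inj₁ x∈S))) ,
                       (λ { refl → x∉ (x∈p∪q⁺ {p = S} (inj₂ (x∈⁅x⁆ x))) })

Disjoint : ∀ {n} → Subset n → Subset n → Set
Disjoint D S = ∀ {x} → x ∈ D → x ∉ S

sing-disjoint : ∀ {n} {d : Fin n} {S} → d ∉ S → Disjoint (sing d) S
sing-disjoint d∉S x∈ rewrite ∈sing⁻ x∈ = d∉S

pair-disjoint : ∀ {n} {d w : Fin n} {S} → d ∉ S → w ∉ S → Disjoint (pair d w) S
pair-disjoint d∉S w∉S x∈ with ∈pair⁻ x∈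
... | inj₁ refl = d∉S
... | inj₂ refl = w∉S

module Game {n} (a : Adj n) where

  ¬stallerWon : ∀ {D S} → Dominating a D → Disjoint D S → ¬ StallerWon a S
  ¬stallerWon dom disjoint won with won _ dom
  ... | x , x∈D , x∈S = disjoint x∈D x∈S

  ¬stallerWon-∅ : ¬ StallerWon a ∅
  ¬stallerWon-∅ = ¬stallerWon {D = ⊤} (λ _ → inj₁ ∈⊤) (λ _ → ∉⊥)

  dominating-⊆ : ∀ {D D'} → D ⊆ D' → Dominating a D → Dominating a D'
  dominating-⊆ D⊆D' dom z with dom z
  ... | inj₁ z∈D = inj₁ (D⊆D' z∈D)
  ... | inj₂ (u , u∈D , uz) = inj₂ (u , D⊆D' u∈D , uz)

  dominates⇒dominating : ∀ {d D z} → d ∈ D → Dominates a d z →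
                         z ∈ D ⊎ (Σ (Fin n) λ u → u ∈ D × a u z ≡ true)
  dominates⇒dominating d∈D (inj₁ refl) = inj₁ d∈D
  dominates⇒dominating d∈D (inj₂ dz) = inj₂ (_ , d∈D , dz)

  universal⇒dominating : ∀ {d D} → d ∈ D → Universal a d → Dominating a D
  universal⇒dominating d∈D univ z = dominates⇒dominating d∈D (univ z)

  dominatingPair⇒dominating : ∀ {d w D} → d ∈ D → w ∈ D → DominatingPair a d w → Dominating a D
  dominatingPair⇒dominating d∈D w∈D p z with p z
  ... | inj₁ dz = dominates⇒dominating d∈D dz
  ... | inj₂ wz = dominates⇒dominating w∈D wz

  dominating⇒universal : ∀ {d} → Dominating a (sing d) → Universal a d
  dominating⇒universal dom z with dom z
  ... | inj₁ z∈ = inj₁ (∈sing⁻ z∈)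
  ... | inj₂ (u , u∈ , uz) with ∈sing⁻ u∈
  ...   | refl = inj₂ uz

  dominating⇒dominatingPair : ∀ {d w} → Dominating a (pair d w) → DominatingPair a d w
  dominating⇒dominatingPair dom z with dom z
  ... | inj₁ z∈ with ∈pair⁻ z∈
  ...   | inj₁ refl = inj₁ (inj₁ refl)
  ...   | inj₂ refl = inj₂ (inj₁ refl)
  dominating⇒dominatingPair dom z | inj₂ (u , u∈ , uz) with ∈pair⁻ u∈
  ...   | inj₁ refl = inj₁ (inj₂ uz)
  ...   | inj₂ refl = inj₂ (inj₂ uz)

  -- If nothing is left to select and Staller has not won, then any dominating set D'
  -- avoids S and hence lies inside D.
  covered⇒dominating : ∀ {D S} → (∀ y → y ∈ D ⊎ y ∈ S) → ¬ StallerWon a S → Dominating a D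
  covered⇒dominating {D} {S} covered ¬won with dominating? a D
  ... | yes dom = dom
  ... | no ¬dom = ⊥-elim (¬won won)
    where
    won : StallerWon a S
    won D' dom' with any? (λ v → (v ∈? D') ×-dec (v ∈? S))
    ... | yes common = common
    ... | no ¬common = ⊥-elim (¬dom (dominating-⊆ D'⊆D dom'))
      where
      D'⊆D : D' ⊆ D
      D'⊆D {y} y∈D' with covered y
      ... | inj₁ y∈D = y∈D
      ... | inj₂ y∈S = ⊥-elim (¬common (y , y∈D' , y∈S))

  sWin₀⇒dominating : ∀ {D S} → SWin a 0 D S → Dominating a D
  sWin₀⇒dominating (s-done dom) = dom
  sWin₀⇒dominating {D} {S} (s-all ¬won next) with any? (λ y → ¬? (y ∈? D) ×-dec ¬? (y ∈? S))
  ... | yes (y , y∉D , y∉S) with proj₂ (next y y∉D y∉S)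
  ...   | d-done dom = dom
  sWin₀⇒dominating {D} {S} (s-all ¬won next) | no ¬free = covered⇒dominating covered ¬won
    where
    covered : ∀ y → y ∈ D ⊎ y ∈ S
    covered y with y ∈? D | y ∈? S
    ... | yes y∈D | _      = inj₁ y∈D
    ... | no _    | yes y∈S = inj₂ y∈S
    ... | no y∉D  | no y∉S  = ⊥-elim (¬free (y , y∉D , y∉S))

  mutual
    dWin-mono : ∀ {j k D S} → j ≤ k → DWin a j D S → DWin a k D S
    dWin-mono _         (d-done dom)               = d-done dom
    dWin-mono (s≤s j≤k) (d-move ¬won u u∉D u∉S w) = d-move ¬won u u∉D u∉S (sWin-mono j≤k w)

    sWin-mono : ∀ {j k D S} → j ≤ k → SWin a j D S → SWin a k D S
    sWin-mono _   (s-done dom)      = s-done dom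
    sWin-mono j≤k (s-all ¬won next) = s-all ¬won λ v v∉D v∉S →
      proj₁ (next v v∉D v∉S) , dWin-mono j≤k (proj₂ (next v v∉D v∉S))

  winning-move : ∀ {k D S} d → d ∉ D → d ∉ S → Dominating a (D ∪ ⁅ d ⁆) →
                Disjoint (D ∪ ⁅ d ⁆) S → DWin a (suc k) D S
  winning-move d d∉D d∉S dom disjoint = d-move (¬stallerWon dom disjoint) d d∉D d∉S (s-done dom)

  universal-reply : ∀ {k d v} → d ≢ v → Universal a d → ¬ StallerWon a (sing v) × DWin a (suc k) ∅ (sing v)
  universal-reply {d = d} d≢v univ = ¬stallerWon dom disjoint , winning-move d ∉⊥ (∉sing⁺ d≢v) dom disjoint
    where
    dom = universal⇒dominating ∈sing⁺ univ
    disjoint = sing-disjoint (∉sing⁺ d≢v)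

  answerable₁⇒sWin₁ : Answerable₁ a → SWin a 1 ∅ ∅
  answerable₁⇒sWin₁ answer = s-all ¬stallerWon-∅ λ v _ _ →
    universal-reply (proj₁ (proj₂ (answer v))) (proj₂ (proj₂ (answer v)))

  sWin₁⇒answerable₁ : ¬ Dominating a ∅ → SWin a 1 ∅ ∅ → Answerable₁ a
  sWin₁⇒answerable₁ ¬dom (s-done dom) = ⊥-elim (¬dom dom)
  sWin₁⇒answerable₁ ¬dom (s-all _ next) v with proj₂ (next v ∉⊥ ∉⊥)
  ... | d-done dom = ⊥-elim (¬dom dom)
  ... | d-move _ d _ d∉S w =
    d , ∉sing⁻ d∉S , dominating⇒universal (sWin₀⇒dominating w)

  answerable₂⇒sWin₂ : Answerable₂ a → SWin a 2 ∅ ∅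
  answerable₂⇒sWin₂ answer = s-all ¬stallerWon-∅ λ v _ _ → reply v (answer v)
    where
    reply : ∀ v → Σ (Fin n) (λ d → d ≢ v × (Universal a d ⊎ TwoPartners a v d)) →
            ¬ StallerWon a (sing v) × DWin a 2 ∅ (sing v)
    reply v (d , d≢v , inj₁ univ) = universal-reply d≢v univ
    reply v (d , d≢v , inj₂ (w₁ , w₂ , w₁≢w₂ , p₁@(w₁≢v , _ , d-w₁) , p₂)) =
      ¬won , d-move ¬won d ∉⊥ (∉sing⁺ d≢v) (s-all ¬won finish)
      where
      ¬won : ¬ StallerWon a (sing v)
      ¬won = ¬stallerWon (dominatingPair⇒dominating ∈pair⁺ˡ ∈pair⁺ʳ d-w₁)
                         (pair-disjoint (∉sing⁺ d≢v) (∉sing⁺ w₁≢v))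

      finish : ∀ x → x ∉ sing d → x ∉ sing v →
               ¬ StallerWon a (pair v x) × DWin a 1 (sing d) (pair v x)
      finish x x∉d _ with one-of-two-avoids w₁≢w₂ p₁ p₂ x
      ... | w , (w≢v , w≢d , d-w) , w≢x = ¬stallerWon dom disjoint ,
                                          winning-move w (∉sing⁺ w≢d) (∉pair⁺ w≢v w≢x) dom disjoint
        where
        dom = dominatingPair⇒dominating ∈pair⁺ˡ ∈pair⁺ʳ d-w
        disjoint = pair-disjoint (∉pair⁺ d≢v (≢-sym (∉sing⁻ x∉d))) (∉pair⁺ w≢v w≢x)

  -- After the opening moves v and d, Staller tries some third vertex x; Dominator's answer
  -- w₁ is a partner of d, and Staller's alternative move w₁ is answered by a second one.
  second-round : ∀ {d v} → d ≢ v → SWin a 1 (sing d) (sing v) → Universal a d ⊎ TwoPartners a v d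
  second-round _ (s-done dom) = inj₁ (dominating⇒universal dom)
  second-round {d} {v} d≢v (s-all ¬won next) with any? (λ x → ¬? (x ≟ v) ×-dec ¬? (x ≟ d))
  ... | no ¬third = inj₁ (dominating⇒universal (covered⇒dominating covered ¬won))
    where
    covered : ∀ y → y ∈ sing d ⊎ y ∈ sing v
    covered y with y ≟ d | y ≟ v
    ... | yes refl | _        = inj₁ ∈sing⁺
    ... | no _     | yes refl = inj₂ ∈sing⁺
    ... | no y≢d   | no y≢v   = ⊥-elim (¬third (y , y≢v , y≢d))
  ... | yes (x , x≢v , x≢d) with proj₂ (next x (∉sing⁺ x≢d) (∉sing⁺ x≢v))
  ...   | d-done dom = inj₁ (dominating⇒universal dom)
  ...   | d-move _ w₁ w₁∉d w₁∉vx w₁-round with ∉∪⁅⁆⁻ w₁∉vx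
  ...     | w₁∉v , _ with proj₂ (next w₁ w₁∉d w₁∉v)
  ...       | d-done dom = inj₁ (dominating⇒universal dom)
  ...       | d-move _ w₂ w₂∉d w₂∉vw₁ w₂-round with ∉∪⁅⁆⁻ w₂∉vw₁
  ...         | w₂∉v , w₂≢w₁ =
    inj₂ (w₁ , w₂ , ≢-sym w₂≢w₁ ,
          (∉sing⁻ w₁∉v , ∉sing⁻ w₁∉d , dominating⇒dominatingPair (sWin₀⇒dominating w₁-round)) ,
          (∉sing⁻ w₂∉v , ∉sing⁻ w₂∉d , dominating⇒dominatingPair (sWin₀⇒dominating w₂-round)))

  sWin₂⇒answerable₂ : ¬ Dominating a ∅ → SWin a 2 ∅ ∅ → Answerable₂ a
  sWin₂⇒answerable₂ ¬dom (s-done dom) = ⊥-elim (¬dom dom)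
  sWin₂⇒answerable₂ ¬dom (s-all _ next) v with proj₂ (next v ∉⊥ ∉⊥)
  ... | d-done dom = ⊥-elim (¬dom dom)
  ... | d-move _ d _ d∉v w = d , ∉sing⁻ d∉v , second-round (∉sing⁻ d∉v) w

two-universal⇒answerable₁ : ∀ {n} {a : Adj n} {u u'} → u ≢ u' → Universal a u → Universal a u' →
                            Answerable₁ a
two-universal⇒answerable₁ {u = u} {u'} u≢u' univ univ' v with v ≟ u
... | yes refl = u' , ≢-sym u≢u' , univ'
... | no v≢u   = u , ≢-sym v≢u , univ

dominatingPair-from-cover : ∀ {n} {a : Adj n} {t w x y} → Dominates a t x → Dominates a t y →
                            (∀ z → z ≢ x → z ≢ y → Dominates a w z) → DominatingPair a t w
dominatingPair-from-cover {x = x} {y} tx ty cover z with z ≟ x | z ≟ y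
... | yes refl | _        = inj₁ tx
... | no _     | yes refl = inj₁ ty
... | no z≢x   | no z≢y   = inj₂ (cover z z≢x z≢y)

removeEdge-true : ∀ {n} (a : Adj n) {u v s t} → a s t ≡ true →
                  ¬ (s ≡ u × t ≡ v) → ¬ (s ≡ v × t ≡ u) → removeEdge a u v s t ≡ true
removeEdge-true a {u} {v} {s} {t} st ¬uv ¬vu rewrite st with s ≟ u | t ≟ v | s ≟ v | t ≟ u
... | yes s≡u | yes t≡v | _       | _       = ⊥-elim (¬uv (s≡u , t≡v))
... | _       | _       | yes s≡v | yes t≡u = ⊥-elim (¬vu (s≡v , t≡u))
... | yes _   | no _    | yes _   | no _    = refl
... | yes _   | no _    | no _    | _       = refl
... | no _    | _       | yes _   | no _    = refl
... | no _    | _       | no _    | _       = refl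

module _ {n} {a : Adj n} where

  Reach-trans : ∀ {x y z} → Reach a x y → Reach a y z → Reach a x z
  Reach-trans here        r = r
  Reach-trans (step e r₁) r = step e (Reach-trans r₁ r)

  first-edge : ∀ {s t} → Reach a s t → s ≢ t → Σ (Fin n) λ y → a s y ≡ true
  first-edge here       s≢s = ⊥-elim (s≢s refl)
  first-edge (step e _) _   = _ , e

  exit-edge : (A : Fin n → Set) → (∀ z → Dec (A z)) → ∀ {s t} → Reach a s t → A s → ¬ A t →
              Σ (Fin n) λ p → Σ (Fin n) λ q → A p × ¬ A q × a p q ≡ true
  exit-edge A A? here                   As ¬At = ⊥-elim (¬At As)
  exit-edge A A? (step {y = m} e r) As ¬At with A? m
  ... | yes Am = exit-edge A A? r Am ¬At
  ... | no ¬Am = _ , m , As , ¬Am , e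

module _ {n} (G : Graph n) where

  adj-sym : ∀ {x y} → adj G x y ≡ true → adj G y x ≡ true
  adj-sym {x} {y} xy = trans (symm G y x) xy

  adj-irrefl : ∀ {x y} → adj G x y ≡ true → x ≢ y
  adj-irrefl {x} xx refl with trans (sym xx) (irrefl G x)
  ... | ()

  Reach-reverse : ∀ {x y} → Reach (adj G) x y → Reach (adj G) y x
  Reach-reverse here       = here
  Reach-reverse (step e r) = Reach-trans (Reach-reverse r) (step (adj-sym e) here)

  connected-via : ∀ c → (∀ x → Reach (adj G) x c) → Connected G
  connected-via c toC x y = Reach-trans (toC x) (Reach-reverse (toC y))

γ>⇒¬sWin : ∀ {n} {a : Adj n} {k} → (∀ m → IsGammaMB' a m → fin k <∞ m) →
           ∀ j → j ≤ k → ¬ SWin a j ∅ ∅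
γ>⇒¬sWin {a = a} {k} γ> = <-rec (λ j → j ≤ k → ¬ SWin a j ∅ ∅) below
  where
  below : ∀ j → (∀ {i} → i < j → i ≤ k → ¬ SWin a i ∅ ∅) → j ≤ k → ¬ SWin a j ∅ ∅
  below j ih j≤k w with γ> (fin j) (w , λ i i<j → ih i<j (≤-trans (<⇒≤ i<j) j≤k))
  ... | fin<fin k<j = <⇒≱ k<j j≤k

count-cong : ∀ {n} (p q : Fin n → Bool) → (∀ i → p i ≡ q i) → count p ≡ count q
count-cong {zero}  p q p≗q = refl
count-cong {suc n} p q p≗q with p zero | q zero | p≗q zero
... | true  | .true  | refl = cong suc (count-cong (p ∘ suc) (q ∘ suc) (p≗q ∘ suc))
... | false | .false | refl = count-cong (p ∘ suc) (q ∘ suc) (p≗q ∘ suc)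

count+count-not : ∀ {n} (p : Fin n → Bool) → count p + count (not ∘ p) ≡ n
count+count-not {zero}  p = refl
count+count-not {suc n} p with p zero
... | true  = cong suc (count+count-not (p ∘ suc))
... | false = trans (+-suc (count (p ∘ suc)) _) (cong suc (count+count-not (p ∘ suc)))

1≤count : ∀ {n} (p : Fin n → Bool) {i} → p i ≡ true → 1 ≤ count p
1≤count {suc n} p {i} pi with p zero in p0
... | true  = s≤s z≤n
... | false with i
...   | zero  = case trans (sym pi) p0 of λ ()
...   | suc i = 1≤count (p ∘ suc) pi

2≤count : ∀ {n} (p : Fin n → Bool) {i j} → i ≢ j → p i ≡ true → p j ≡ true → 2 ≤ count p
2≤count {suc n} p {zero}  {zero}  i≢j _  _  = ⊥-elim (i≢j refl)
2≤count {suc n} p {zero}  {suc j} _   pi pj rewrite pi = s≤s (1≤count (p ∘ suc) pj)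
2≤count {suc n} p {suc i} {zero}  _   pi pj rewrite pj = s≤s (1≤count (p ∘ suc) pi)
2≤count {suc n} p {suc i} {suc j} i≢j pi pj with p zero
... | true  = s≤s (1≤count (p ∘ suc) pi)
... | false = 2≤count (p ∘ suc) (i≢j ∘ cong suc) pi pj

count≤n∸2 : ∀ {n} (p : Fin n → Bool) {i j} → i ≢ j → p i ≡ false → p j ≡ false → count p ≤ n ∸ 2
count≤n∸2 {n} p i≢j pi pj = begin
  count p                                     ≡⟨ m+n∸n≡m (count p) (count (not ∘ p)) ⟨
  count p + count (not ∘ p) ∸ count (not ∘ p) ≡⟨ cong (_∸ count (not ∘ p)) (count+count-not p) ⟩
  n ∸ count (not ∘ p)                         ≤⟨ ∸-monoʳ-≤ n (2≤count (not ∘ p) i≢j (cong not pi) (cong not pj)) ⟩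
  n ∸ 2                                       ∎
  where open ≤-Reasoning

4≤n : ∀ {n} → 2 ≤ n ∸ 2 → 4 ≤ n
4≤n {suc (suc n)} 2≤n∸2 = s≤s (s≤s 2≤n∸2)

module Critical₂ {n} (G : Graph n) (critical : Critical 2 G) where

  private
    a = adj G

  ¬dominating-∅ : ¬ Dominating a ∅
  ¬dominating-∅ dom = proj₂ (proj₁ critical) 0 (s≤s z≤n) (s-done dom)

  answerable₂ : Answerable₂ a
  answerable₂ = Game.sWin₂⇒answerable₂ a ¬dominating-∅ (proj₁ (proj₁ critical))

  ¬answerable₁ : ¬ Answerable₁ a
  ¬answerable₁ answer = proj₂ (proj₁ critical) 1 (s≤s (s≤s z≤n)) (Game.answerable₁⇒sWin₁ a answer)

  ¬answerable₂-removeEdge : ∀ {u v} → a u v ≡ true → ¬ Answerable₂ (removeEdge a u v)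
  ¬answerable₂-removeEdge {u} {v} uv answer =
    γ>⇒¬sWin (proj₂ critical u v uv) 2 ≤-refl (Game.answerable₂⇒sWin₂ _ answer)

  ¬two-universal : ∀ {u u'} → u ≢ u' → Universal a u → Universal a u' → ⊥
  ¬two-universal u≢u' univ univ' = ¬answerable₁ (two-universal⇒answerable₁ u≢u' univ univ')

  module Leaf (x y : Fin n) (xy : a x y ≡ true) (only-neighbour : ∀ {z} → a x z ≡ true → z ≡ y) where

    x≢y : x ≢ y
    x≢y = adj-irrefl G xy

    dominator-of-leaf : ∀ {d} → Dominates a d x → x ≡ d ⊎ d ≡ y
    dominator-of-leaf (inj₁ x≡d) = inj₁ x≡d
    dominator-of-leaf (inj₂ dx)  = inj₂ (only-neighbour (adj-sym G dx))

    ¬universal : ∀ {d} → d ≢ y → ¬ Universal a d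
    ¬universal d≢y univ with dominator-of-leaf (univ x)
    ... | inj₂ d≡y = d≢y d≡y
    ... | inj₁ refl = ¬two-universal x≢y univ univ-y
      where
      univ-y : Universal a y
      univ-y z with z ≟ y | z ≟ x | univ z
      ... | yes z≡y | _        | _         = inj₁ z≡y
      ... | no _    | yes refl | _         = inj₂ (adj-sym G xy)
      ... | no _    | no z≢x   | inj₁ z≡x  = ⊥-elim (z≢x z≡x)
      ... | no z≢y  | no _     | inj₂ xz   = ⊥-elim (z≢y (only-neighbour xz))

    leaf-in-pair : ∀ {d w} → d ≢ y → w ≢ y → DominatingPair a d w → x ≡ d ⊎ x ≡ w
    leaf-in-pair d≢y w≢y p with p x
    ... | inj₁ dx with dominator-of-leaf dx
    ...   | inj₁ x≡d = inj₁ x≡d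
    ...   | inj₂ d≡y = ⊥-elim (d≢y d≡y)
    leaf-in-pair d≢y w≢y p | inj₂ wx with dominator-of-leaf wx
    ...   | inj₁ x≡w = inj₂ x≡w
    ...   | inj₂ w≡y = ⊥-elim (w≢y w≡y)

    answer-to-neighbour : TwoPartners a y x
    answer-to-neighbour with answerable₂ y
    ... | d , d≢y , inj₁ univ = ⊥-elim (¬universal d≢y univ)
    ... | d , d≢y , inj₂ partners@(w₁ , w₂ , w₁≢w₂ , (w₁≢y , _ , d-w₁) , (w₂≢y , _ , d-w₂))
        with leaf-in-pair d≢y w₁≢y d-w₁ | leaf-in-pair d≢y w₂≢y d-w₂
    ...   | inj₁ refl | _         = partners
    ...   | _         | inj₁ refl = partners
    ...   | inj₂ x≡w₁ | inj₂ x≡w₂ = ⊥-elim (w₁≢w₂ (trans (sym x≡w₁) x≡w₂))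

    partner-covers : ∀ {w} → Partner a y x w → ∀ z → z ≢ x → z ≢ y → Dominates a w z
    partner-covers (_ , _ , x-w) z z≢x z≢y with x-w z
    ... | inj₁ (inj₁ z≡x) = ⊥-elim (z≢x z≡x)
    ... | inj₁ (inj₂ xz)  = ⊥-elim (z≢y (only-neighbour xz))
    ... | inj₂ wz         = wz

    -- In G - yp the pairs {x, wᵢ} and {y, wᵢ} still dominate, so every opening is answered
    -- by x, by y, or by a partner wᵢ together with x and y.
    module _ {p} (yp : a y p ≡ true) (p≢x : p ≢ x) (p≢y : p ≢ y) where

      private
        b = removeEdge a y p

      covers : ∀ {w} → Partner a y x w → ∀ z → z ≢ x → z ≢ y → Dominates b w z
      covers pw@(w≢y , _ , _) z z≢x z≢y with partner-covers pw z z≢x z≢y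
      ... | inj₁ z≡w = inj₁ z≡w
      ... | inj₂ wz  = inj₂ (removeEdge-true a wz (w≢y ∘ proj₁) (z≢y ∘ proj₂))

      pair-x : ∀ {w} → Partner a y x w → DominatingPair b x w
      pair-x pw = dominatingPair-from-cover (inj₁ refl)
        (inj₂ (removeEdge-true a xy (x≢y ∘ proj₁) (p≢x ∘ sym ∘ proj₁))) (covers pw)

      pair-y : ∀ {w} → Partner a y x w → DominatingPair b y w
      pair-y pw = dominatingPair-from-cover
        (inj₂ (removeEdge-true a (adj-sym G xy) (p≢x ∘ sym ∘ proj₂) (p≢y ∘ sym ∘ proj₁))) (inj₁ refl) (covers pw)

      answerable-without-yp : TwoPartners a y x → Answerable₂ b
      answerable-without-yp (w₁ , w₂ , w₁≢w₂ , p₁@(w₁≢y , w₁≢x , _) , p₂@(w₂≢y , w₂≢x , _)) v with v ≟ y | v ≟ x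
      ... | yes refl | _ =
        x , x≢y , inj₂ (w₁ , w₂ , w₁≢w₂ , (w₁≢y , w₁≢x , pair-x p₁) , (w₂≢y , w₂≢x , pair-x p₂))
      ... | no _ | yes refl =
        y , ≢-sym x≢y , inj₂ (w₁ , w₂ , w₁≢w₂ , (w₁≢x , w₁≢y , pair-y p₁) , (w₂≢x , w₂≢y , pair-y p₂))
      ... | no v≢y | no v≢x with one-of-two-avoids w₁≢w₂ p₁ p₂ v
      ...   | w , pw@(w≢y , w≢x , _) , w≢v =
        w , w≢v , inj₂ (x , y , x≢y , (≢-sym v≢x , ≢-sym w≢x , swapPair (pair-x pw))
                                    , (≢-sym v≢y , ≢-sym w≢y , swapPair (pair-y pw)))

    impossible : Connected G → ⊥
    impossible conn with answer-to-neighbour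
    ... | partners@(w₁ , _ , _ , (w₁≢y , w₁≢x , _) , _)
        with exit-edge (λ z → z ≢ x × z ≢ y) (λ z → ¬? (z ≟ x) ×-dec ¬? (z ≟ y))
                       (conn w₁ x) (w₁≢x , w₁≢y) (λ (x≢x , _) → x≢x refl)
    ...   | p , q , (p≢x , p≢y) , q∉ , pq with q ≟ x | q ≟ y
    ...     | yes refl | _        = p≢y (only-neighbour (adj-sym G pq))
    ...     | no q≢x   | no q≢y   = q∉ (q≢x , q≢y)
    ...     | no _     | yes refl = ¬answerable₂-removeEdge yp (answerable-without-yp yp p≢x p≢y partners)
      where
      yp = adj-sym G pq

  module UniversalVertex (u : Fin n) (univ : Universal a u) where

    from-u : ∀ {s} → s ≢ u → a u s ≡ true
    from-u {s} s≢u with univ s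
    ... | inj₁ s≡u = ⊥-elim (s≢u s≡u)
    ... | inj₂ us  = us

    -- In G - uz, u still dominates everything but z, and d with its partners answers
    -- every opening except d, z and z'; for those, the pairs with u take over.
    module _ {d z z'} (d≢u : d ≢ u) (z≢z' : z ≢ z')
             (pz : Partner a u d z) (pz' : Partner a u d z')
             {q} (zq : a z q ≡ true) (q≢u : q ≢ u) (q≢d : q ≢ d) where

      private
        b = removeEdge a u z
        z≢u = proj₁ pz
        z≢d = proj₁ (proj₂ pz)
        z'≢u = proj₁ pz'
        z'≢d = proj₁ (proj₂ pz')
        z≢q = adj-irrefl G zq

      kept : ∀ {s t} → s ≢ u → s ≢ z → a s t ≡ true → b s t ≡ true
      kept s≢u s≢z st = removeEdge-true a st (s≢u ∘ proj₁) (s≢z ∘ proj₁)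

      kept-dominates : ∀ {s t} → s ≢ u → s ≢ z → Dominates a s t → Dominates b s t
      kept-dominates s≢u s≢z (inj₁ t≡s) = inj₁ t≡s
      kept-dominates s≢u s≢z (inj₂ st)  = inj₂ (kept s≢u s≢z st)

      u-covers : ∀ t → t ≢ z → Dominates b u t
      u-covers t t≢z with univ t
      ... | inj₁ t≡u = inj₁ t≡u
      ... | inj₂ ut  = inj₂ (removeEdge-true a ut (t≢z ∘ proj₂) (z≢u ∘ sym ∘ proj₁))

      with-u : ∀ {t} → Dominates b t z → DominatingPair b t u
      with-u tz = dominatingPair-from-cover tz tz λ s s≢z _ → u-covers s s≢z

      d-z : DominatingPair b d z
      d-z s with proj₂ (proj₂ pz) s
      ... | inj₁ ds              = inj₁ (kept-dominates d≢u (≢-sym z≢d) ds)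
      ... | inj₂ (inj₁ s≡z)      = inj₂ (inj₁ s≡z)
      ... | inj₂ (inj₂ zs)       = via-z (s ≟ u) zs
        where
        -- s ≟ u is an argument here because `with` would also abstract it inside b.
        via-z : ∀ {s} → Dec (s ≡ u) → a z s ≡ true → Dominates b d s ⊎ Dominates b z s
        via-z (yes refl) _  = inj₁ (inj₂ (kept d≢u (≢-sym z≢d) (adj-sym G (from-u d≢u))))
        via-z (no s≢u)   zs = inj₂ (inj₂ (removeEdge-true a zs (z≢u ∘ proj₁) (s≢u ∘ proj₂)))

      d-z' : DominatingPair b d z'
      d-z' s with proj₂ (proj₂ pz') s
      ... | inj₁ ds  = inj₁ (kept-dominates d≢u (≢-sym z≢d) ds)
      ... | inj₂ z's = inj₂ (kept-dominates z'≢u (≢-sym z≢z') z's)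

      z-u : DominatingPair b z u
      z-u = with-u (inj₁ refl)

      q-u : DominatingPair b q u
      q-u = with-u (inj₂ (kept q≢u (≢-sym z≢q) (adj-sym G zq)))

      answer-z : Σ (Fin n) λ d' → d' ≢ z × (Universal b d' ⊎ TwoPartners b z d')
      answer-z with proj₂ (proj₂ pz') z
      ... | inj₁ (inj₁ z≡d)  = ⊥-elim (z≢d z≡d)
      ... | inj₂ (inj₁ z≡z') = ⊥-elim (z≢z' z≡z')
      ... | inj₁ (inj₂ dz)   =
        d , ≢-sym z≢d , inj₂ (z' , u , z'≢u , (≢-sym z≢z' , z'≢d , d-z')
                                , (≢-sym z≢u , ≢-sym d≢u , with-u (inj₂ (kept d≢u (≢-sym z≢d) dz))))
      ... | inj₂ (inj₂ z'z)  =
        z' , ≢-sym z≢z' , inj₂ (u , d , ≢-sym d≢u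
                                , (≢-sym z≢u , ≢-sym z'≢u , with-u (inj₂ (kept z'≢u (≢-sym z≢z') z'z)))
                                , (≢-sym z≢d , ≢-sym z'≢d , swapPair {a = b} d-z'))

      answerable-without-uz : Answerable₂ b
      answerable-without-uz v with v ≟ d | v ≟ z | v ≟ z'
      ... | yes refl | _ | _ =
        u , ≢-sym d≢u , inj₂ (z , q , z≢q , (z≢d , z≢u , swapPair {a = b} z-u) , (q≢d , q≢u , swapPair {a = b} q-u))
      ... | no _ | yes refl | _ = answer-z
      ... | no _ | no _ | yes refl =
        z , z≢z' , inj₂ (u , d , ≢-sym d≢u , (≢-sym z'≢u , ≢-sym z≢u , z-u) , (≢-sym z'≢d , ≢-sym z≢d , swapPair {a = b} d-z))
      ... | no v≢d | no v≢z | no v≢z' =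
        d , ≢-sym v≢d , inj₂ (z , z' , z≢z' , (≢-sym v≢z , z≢d , d-z) , (≢-sym v≢z' , z'≢d , d-z'))

    -- The partners of d have no neighbours outside {u, d}, so d is universal as well.
    impossible : ⊥
    impossible with answerable₂ u
    ... | d , d≢u , inj₁ univ-d = ¬two-universal d≢u univ-d univ
    ... | d , d≢u , inj₂ (z , z' , z≢z' , pz , pz') = ¬two-universal d≢u univ-d univ
      where
      neighbours : ∀ {w w'} → w ≢ w' → Partner a u d w → Partner a u d w' →
                   ∀ {s} → a w s ≡ true → s ≡ u ⊎ s ≡ d
      neighbours w≢w' pw pw' {s} ws with s ≟ u | s ≟ d
      ... | yes s≡u | _       = inj₁ s≡u
      ... | _       | yes s≡d = inj₂ s≡d
      ... | no s≢u  | no s≢d  =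
        ⊥-elim (¬answerable₂-removeEdge (from-u (proj₁ pw)) (answerable-without-uz d≢u w≢w' pw pw' ws s≢u s≢d))

      dz : a d z ≡ true
      dz with proj₂ (proj₂ pz') z
      ... | inj₁ (inj₁ z≡d)  = ⊥-elim (proj₁ (proj₂ pz) z≡d)
      ... | inj₁ (inj₂ dz)   = dz
      ... | inj₂ (inj₁ z≡z') = ⊥-elim (z≢z' z≡z')
      ... | inj₂ (inj₂ z'z) with neighbours (≢-sym z≢z') pz' pz z'z
      ...   | inj₁ z≡u = ⊥-elim (proj₁ pz z≡u)
      ...   | inj₂ z≡d = ⊥-elim (proj₁ (proj₂ pz) z≡d)

      univ-d : Universal a d
      univ-d s with s ≟ d | s ≟ u | proj₂ (proj₂ pz) s
      ... | yes s≡d | _        | _               = inj₁ s≡d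
      ... | no _    | yes refl | _               = inj₂ (adj-sym G (from-u d≢u))
      ... | no _    | no _     | inj₁ ds         = ds
      ... | no _    | no _     | inj₂ (inj₁ refl) = inj₂ dz
      ... | no s≢d  | no s≢u   | inj₂ (inj₂ zs) with neighbours z≢z' pz pz' zs
      ...   | inj₁ s≡u = ⊥-elim (s≢u s≡u)
      ...   | inj₂ s≡d = ⊥-elim (s≢d s≡d)

  2≤degree : Connected G → ∀ x → 2 ≤ degree G x
  2≤degree conn x with 2 ≤? degree G x
  ... | yes 2≤deg = 2≤deg
  ... | no 2≰deg with answerable₂ x
  ...   | d , d≢x , _ with first-edge (conn x d) (≢-sym d≢x)
  ...     | y , xy = ⊥-elim (Leaf.impossible x y xy only-neighbour conn)
    where
    only-neighbour : ∀ {z} → a x z ≡ true → z ≡ y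
    only-neighbour {z} xz with z ≟ y
    ... | yes z≡y = z≡y
    ... | no z≢y  = ⊥-elim (2≰deg (2≤count (a x) z≢y xz xy))

  degree≤n∸2 : ∀ u → degree G u ≤ n ∸ 2
  degree≤n∸2 u with degree G u ≤? n ∸ 2
  ... | yes deg≤ = deg≤
  ... | no deg≰  = ⊥-elim (UniversalVertex.impossible u univ)
    where
    univ : Universal a u
    univ z with z ≟ u
    ... | yes z≡u = inj₁ z≡u
    ... | no z≢u with a u z in uz
    ...   | true  = inj₂ refl
    ...   | false = ⊥-elim (deg≰ (count≤n∸2 (a u) (≢-sym z≢u) (irrefl G u) uz))

  4≤order : Connected G → Fin n → 4 ≤ n
  4≤order conn v = 4≤n (≤-trans (2≤degree conn v) (degree≤n∸2 v))

module _ {n} {a a' : Adj n} (a≗a' : ∀ x y → a x y ≡ a' x y) where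

  answerable₂-cong : Answerable₂ a' → Answerable₂ a
  answerable₂-cong answer v = transport (answer v)
    where
    dominates : ∀ {d z} → Dominates a' d z → Dominates a d z
    dominates = map₂ (trans (a≗a' _ _))

    partner : ∀ {d w} → Partner a' v d w → Partner a v d w
    partner (w≢v , w≢d , p) = w≢v , w≢d , λ z → map dominates dominates (p z)

    transport : Σ (Fin n) (λ d → d ≢ v × (Universal a' d ⊎ TwoPartners a' v d)) →
                Σ (Fin n) (λ d → d ≢ v × (Universal a d ⊎ TwoPartners a v d))
    transport (d , d≢v , inj₁ univ) = d , d≢v , inj₁ (dominates ∘ univ)
    transport (d , d≢v , inj₂ (w₁ , w₂ , w₁≢w₂ , p₁ , p₂)) =
      d , d≢v , inj₂ (w₁ , w₂ , w₁≢w₂ , partner p₁ , partner p₂)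

  removeEdge-cong : ∀ u v x y → removeEdge a u v x y ≡ removeEdge a' u v x y
  removeEdge-cong u v x y =
    cong (_∧ not ((⌊ x ≟ u ⌋ ∧ ⌊ y ≟ v ⌋) ∨ (⌊ x ≟ v ⌋ ∧ ⌊ y ≟ u ⌋))) (a≗a' x y)

RemovableEdge : ∀ {n} → Adj n → Set
RemovableEdge {n} a = Σ (Fin n) λ u → Σ (Fin n) λ v → a u v ≡ true × Answerable₂ (removeEdge a u v)

removableEdge? : ∀ {n} (a : Adj n) → Dec (RemovableEdge a)
removableEdge? a = any? λ u → any? λ v → (a u v ≟ᵇ true) ×-dec answerable₂? (removeEdge a u v)

adj₄ : (b₀₁ b₀₂ b₀₃ b₁₂ b₁₃ b₂₃ : Bool) → Adj 4
adj₄ b₀₁ b₀₂ b₀₃ b₁₂ b₁₃ b₂₃ = λ where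
  0F 0F → false ; 0F 1F → b₀₁   ; 0F 2F → b₀₂   ; 0F 3F → b₀₃
  1F 0F → b₀₁   ; 1F 1F → false ; 1F 2F → b₁₂   ; 1F 3F → b₁₃
  2F 0F → b₀₂   ; 2F 1F → b₁₂   ; 2F 2F → false ; 2F 3F → b₂₃
  3F 0F → b₀₃   ; 3F 1F → b₁₃   ; 3F 2F → b₂₃   ; 3F 3F → false

adjacency₄ : Graph 4 → Adj 4
adjacency₄ G = adj₄ (adj G 0F 1F) (adj G 0F 2F) (adj G 0F 3F) (adj G 1F 2F) (adj G 1F 3F) (adj G 2F 3F)

adj≗adjacency₄ : (G : Graph 4) → ∀ x y → adj G x y ≡ adjacency₄ G x y
adj≗adjacency₄ G = λ where
  0F 0F → irrefl G 0F ; 0F 1F → refl          ; 0F 2F → refl          ; 0F 3F → refl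
  1F 0F → symm G 1F 0F ; 1F 1F → irrefl G 1F  ; 1F 2F → refl          ; 1F 3F → refl
  2F 0F → symm G 2F 0F ; 2F 1F → symm G 2F 1F ; 2F 2F → irrefl G 2F   ; 2F 3F → refl
  3F 0F → symm G 3F 0F ; 3F 1F → symm G 3F 1F ; 3F 2F → symm G 3F 2F  ; 3F 3F → irrefl G 3F

Bool-all? : ∀ {P : Bool → Set} → (∀ b → Dec (P b)) → Dec (∀ b → P b)
Bool-all? P? = map′ (λ (f , t) → λ { false → f ; true → t }) (λ h → h false , h true) (P? false ×-dec P? true)

-- The only 2-regular graph on four vertices is C₄, and C₄ minus an edge is P₄, where
-- Dominator still wins in two moves; checked over all 2⁶ adjacency tables. Opaque, since
-- unfolding it at symbolic arguments would normalise the proofs of all 64 cases.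
opaque
  2-regular₄-removableEdge : ∀ b₀₁ b₀₂ b₀₃ b₁₂ b₁₃ b₂₃ → let a = adj₄ b₀₁ b₀₂ b₀₃ b₁₂ b₁₃ b₂₃ in
                             (∀ v → count (a v) ≡ 2) → RemovableEdge a
  2-regular₄-removableEdge = from-yes
    (Bool-all? λ b₀₁ → Bool-all? λ b₀₂ → Bool-all? λ b₀₃ → Bool-all? λ b₁₂ → Bool-all? λ b₁₃ → Bool-all? λ b₂₃ →
       let a = adj₄ b₀₁ b₀₂ b₀₃ b₁₂ b₁₃ b₂₃ in (all? λ v → count (a v) ≟ℕ 2) →-dec removableEdge? a)

¬critical-2-regular₄ : (G : Graph 4) → Critical 2 G → ¬ (∀ v → degree G v ≡ 2)
¬critical-2-regular₄ G critical regular with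
  2-regular₄-removableEdge _ _ _ _ _ _ (λ v → trans (sym (count-cong _ _ (adj≗adjacency₄ G v))) (regular v))
... | u , v , uv , answer =
  Critical₂.¬answerable₂-removeEdge G critical (trans (adj≗adjacency₄ G u v) uv)
    (answerable₂-cong (removeEdge-cong (adj≗adjacency₄ G) u v) answer)

5≤order : ∀ {n} (G : Graph n) → Connected G → Critical 2 G → 5 ≤ n
5≤order {zero}  G _    critical = ⊥-elim (Critical₂.¬dominating-∅ G critical λ ())
5≤order {suc n} G conn critical with m≤n⇒m<n∨m≡n (Critical₂.4≤order G critical conn 0F)
... | inj₁ 4<n  = 4<n
... | inj₂ refl = ⊥-elim (¬critical-2-regular₄ G critical λ v → ≤-antisym (degree≤n∸2 v) (2≤degree conn v))
  where open Critical₂ G critical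

Critical₂Criterion : ∀ {n} → Adj n → Set
Critical₂Criterion a =
  Answerable₂ a × ¬ Answerable₁ a × (∀ u v → a u v ≡ true → ¬ Answerable₂ (removeEdge a u v))

critical₂Criterion? : ∀ {n} (a : Adj n) → Dec (Critical₂Criterion a)
critical₂Criterion? a = answerable₂? a ×-dec ¬? (answerable₁? a) ×-dec
  (all? λ u → all? λ v → (a u v ≟ᵇ true) →-dec ¬? (answerable₂? (removeEdge a u v)))

nonempty⇒¬dominating-∅ : ∀ {n} (a : Adj (suc n)) → ¬ Dominating a ∅
nonempty⇒¬dominating-∅ a dom with dom 0F
... | inj₁ 0∈∅           = ∉⊥ 0∈∅
... | inj₂ (_ , u∈∅ , _) = ∉⊥ u∈∅

critical₂-if : ∀ {n} (G : Graph (suc n)) → Critical₂Criterion (adj G) → Critical 2 G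
critical₂-if G (answer₂ , ¬answer₁ , ¬answer₂-removeEdge) = (sWin₂ , ¬sWin≤1) , γ>2-removeEdge
  where
  open Game
  a = adj G

  sWin₂ : SWin a 2 ∅ ∅
  sWin₂ = answerable₂⇒sWin₂ a answer₂

  ¬sWin≤1 : ∀ j → j < 2 → ¬ SWin a j ∅ ∅
  ¬sWin≤1 j (s≤s j≤1) w = ¬answer₁ (sWin₁⇒answerable₁ a (nonempty⇒¬dominating-∅ a) (sWin-mono a j≤1 w))

  γ>2-removeEdge : ∀ u v → a u v ≡ true → ∀ m → IsGammaMB' (removeEdge a u v) m → fin 2 <∞ m
  γ>2-removeEdge u v uv ∞       _       = fin<∞
  γ>2-removeEdge u v uv (fin k) (w , _) with k ≤? 2
  ... | no k≰2  = fin<fin (≰⇒> k≰2)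
  ... | yes k≤2 = ⊥-elim (¬answer₂-removeEdge u v uv (sWin₂⇒answerable₂ b (nonempty⇒¬dominating-∅ b) sWin₂-b))
    where
    b = removeEdge a u v
    sWin₂-b = sWin-mono b k≤2 w

fromEdges : ∀ {n} → List (Fin n × Fin n) → Adj n
fromEdges es x y = any (λ (u , v) → (⌊ x ≟ u ⌋ ∧ ⌊ y ≟ v ⌋) ∨ (⌊ x ≟ v ⌋ ∧ ⌊ y ≟ u ⌋)) es

decidedGraph : ∀ {n} (a : Adj n) →
               {True (all? λ x → all? λ y → a x y ≟ᵇ a y x)} → {True (all? λ x → a x x ≟ᵇ false)} → Graph n
decidedGraph a {symmetric} {irreflexive} =
  record { adj = a ; symm = toWitness symmetric ; irrefl = toWitness irreflexive }

C₅ : Graph 5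
C₅ = decidedGraph (fromEdges ((0F , 1F) ∷ (1F , 2F) ∷ (2F , 3F) ∷ (3F , 4F) ∷ (4F , 0F) ∷ []))

C₅-connected : Connected C₅
C₅-connected = connected-via C₅ 0F λ where
  0F → here
  1F → step refl here
  2F → step {y = 1F} refl (step refl here)
  3F → step {y = 4F} refl (step refl here)
  4F → step refl here

C₅-critical : Critical 2 C₅
C₅-critical = critical₂-if C₅ (from-yes (critical₂Criterion? (adj C₅)))

K₂,₃ : Graph 5
K₂,₃ = decidedGraph (fromEdges ((0F , 2F) ∷ (0F , 3F) ∷ (0F , 4F) ∷ (1F , 2F) ∷ (1F , 3F) ∷ (1F , 4F) ∷ []))

K₂,₃-connected : Connected K₂,₃
K₂,₃-connected = connected-via K₂,₃ 0F λ where
  0F → here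
  1F → step {y = 2F} refl (step refl here)
  2F → step refl here
  3F → step refl here
  4F → step refl here

K₂,₃-critical : Critical 2 K₂,₃
K₂,₃-critical = critical₂-if K₂,₃ (from-yes (critical₂Criterion? (adj K₂,₃)))

proposition4p4 : ((n : ℕ) (G : Graph n) → Connected G → Critical 2 G →
      (5 ≤ n) × (∀ v → 2 ≤ degree G v) × (∀ v → degree G v ≤ n ∸ 2))
    × (Σ ℕ λ n → Σ (Graph n) λ G → Connected G × Critical 2 G × n ≡ 5)
    × (Σ ℕ λ n → Σ (Graph n) λ G → Connected G × Critical 2 G ×
         (∀ v → 2 ≤ degree G v) × (∃ λ v → degree G v ≡ 2))
    × (Σ ℕ λ n → Σ (Graph n) λ G → Connected G × Critical 2 G ×
         (∀ v → degree G v ≤ n ∸ 2) × (∃ λ v → degree G v ≡ n ∸ 2))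
proposition4p4 =
    (λ n G conn critical → 5≤order G conn critical
                         , Critical₂.2≤degree G critical conn
                         , Critical₂.degree≤n∸2 G critical)
  , (5 , C₅ , C₅-connected , C₅-critical , refl)
  , (5 , C₅ , C₅-connected , C₅-critical , from-yes (all? λ v → 2 ≤? degree C₅ v) , (0F , refl))
  , (5 , K₂,₃ , K₂,₃-connected , K₂,₃-critical , from-yes (all? λ v → degree K₂,₃ v ≤? 3) , (0F , refl))
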